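{- For every positive integer $n$, $$R_n^{D}(t)-R_n^{B-D}(t)=\begin{cases}2t(1-t)(1-t^2)^{k-1}& n=2k,\\ 0& n\text{ odd}.\end{cases}$$
   Context: $\mathfrak{B}_n$ is the group of signed permutations in window notation $\pi=\pi_1\cdots\pi_n$, and $\mathfrak{D}_n\subseteq\mathfrak{B}_n$ the subset with an even number of negative entries. Set $\pi_0=0$; for $\pi\in\mathfrak{B}_n$ let $\mathrm{pk}_B(\pi)$ (resp. $\mathrm{val}_B(\pi)$) be the number of $i\in\{1,\dots,n-1\}$ with $\pi_{i-1}<\pi_i>\pi_{i+1}$ (resp. $\pi_{i-1}>\pi_i<\pi_{i+1}$), and $\mathrm{altruns}_B(\pi)=\mathrm{pk}_B(\pi)+\mathrm{val}_B(\pi)+1$. Define $R_n^D(t)=\sum_{\pi\in\mathfrak{D}_n}t^{\mathrm{altruns}_B(\pi)}$ and $R_n^{B-D}(t)=\sum_{\pi\in\mathfrak{B}_n\setminus\mathfrak{D}_n}t^{\mathrm{altruns}_B(\pi)}$. -}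

module Defs where

open import Data.Bool using (Bool; true; false; if_then_else_; _∧_)
open import Data.Nat as ℕ using (ℕ; zero; suc; _%_)
open import Data.Integer as ℤ using (ℤ; +_; -[1+_]; ∣_∣; _<?_; _-_; _*_; _^_)
open import Data.List using (List; []; _∷_; map; concatMap; filter; length; foldr; upTo)
open import Relation.Nullary.Decidable using (⌊_⌋; ¬?)
open import Relation.Binary.PropositionalEquality using (_≡_)
import Data.List.Relation.Unary.Unique.DecPropositional as UDec

letters : ℕ → List ℤ
letters n = concatMap (λ i → + (suc i) ∷ -[1+ i ] ∷ []) (upTo n)

words : ℕ → ℕ → List (List ℤ)
words n zero    = [] ∷ []
words n (suc m) = concatMap (λ a → map (a ∷_) (words n m)) (letters n)

-- 𝔅ₙ: signed permutations in window notation π₁⋯πₙ, i.e. words of length n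
-- over ±1,…,±n whose absolute values |π₁|,…,|πₙ| are pairwise distinct.
signedPerms : ℕ → List (List ℤ)
signedPerms n = filter (λ w → UDec.unique? ℕ._≟_ (map ∣_∣ w)) (words n n)

neg : List ℤ → ℕ
neg w = length (filter (λ x → x <? + 0) w)

typeD : ℕ → List (List ℤ)
typeD n = filter (λ w → neg w % 2 ℕ.≟ 0) (signedPerms n)

typeBminusD : ℕ → List (List ℤ)
typeBminusD n = filter (λ w → ¬? (neg w % 2 ℕ.≟ 0)) (signedPerms n)

peaksOf : List ℤ → ℕ
peaksOf (x ∷ y ∷ z ∷ r) =
  (if ⌊ x <? y ⌋ ∧ ⌊ z <? y ⌋ then 1 else 0) ℕ.+ peaksOf (y ∷ z ∷ r)
peaksOf _ = 0

valleysOf : List ℤ → ℕ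
valleysOf (x ∷ y ∷ z ∷ r) =
  (if ⌊ y <? x ⌋ ∧ ⌊ y <? z ⌋ then 1 else 0) ℕ.+ valleysOf (y ∷ z ∷ r)
valleysOf _ = 0

pkB : List ℤ → ℕ
pkB π = peaksOf (+ 0 ∷ π)

valB : List ℤ → ℕ
valB π = valleysOf (+ 0 ∷ π)

altrunsB : List ℤ → ℕ
altrunsB π = pkB π ℕ.+ valB π ℕ.+ 1

genAltruns : List (List ℤ) → ℤ → ℤ
genAltruns S t = foldr (λ π acc → t ^ altrunsB π ℤ.+ acc) (+ 0) S

R-D : ℕ → ℤ → ℤ
R-D n = genAltruns (typeD n)

R-BminusD : ℕ → ℤ → ℤ
R-BminusD n = genAltruns (typeBminusD n)

-- R_n^D − R_n^{B−D} is the signed sum Σ_{π ∈ 𝔅ₙ} (−1)^{neg π} t^{altruns_B π}; group the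
-- signed permutations by their sequence of absolute values |π₁|,…,|πₙ|. If that sequence
-- has a local minimum |π_j| < |π_{j−1}| (with |π₀| = 0) and |π_j| < |π_{j+1}| (or j = n),
-- the sign of π_j affects no comparison with its neighbours, hence not altruns_B, while it
-- flips the sign of the term: such groups cancel. The only sequence of distinct values
-- without a local minimum is 1, 2, …, n. On it, π_j (j ≥ 1) is a peak or valley exactly when
-- π_j and π_{j+1} have opposite signs, so its group sum obeys a two-term linear recursion Q,
-- and Q has the value (1 − t²)^k at length 2k for either starting sign.
module Submission where

open import Defs
open import Data.Nat using (ℕ; suc; _∸_; _≤_)
open import Data.Integer using (ℤ; +_; _-_; _*_; _^_)
open import Data.Product using (_×_)
open import Relation.Binary.PropositionalEquality using (_≡_)

open import Data.Bool using (Bool; true; false; if_then_else_; _∧_; _xor_; not; T)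
open import Data.Bool.Properties using (T-∧; T-≡)
open import Data.Empty using (⊥-elim)
open import Data.Integer as ℤ using (+[1+_]; -[1+_]; -1ℤ; ∣_∣; _+_; -_; _<?_)
open import Data.Integer.Properties
  using (+-identityˡ; +-identityʳ; +-assoc; +-inverseʳ; *-identityˡ; *-identityʳ; *-assoc; *-zeroʳ;
         *-distribˡ-+; -1*i≡-i; ^-distribˡ-+-*; *-commutativeSemigroup)
open import Data.Integer.Tactic.RingSolver using (solve-∀)
open import Data.List
  using (List; []; _∷_; _++_; [_]; _∷ʳ_; foldr; map; concatMap; filter; length; upTo)
open import Data.List.Properties using (upTo-∷ʳ)
open import Data.List.Membership.Propositional using (_∈_; find)
open import Data.List.Membership.Propositional.Properties using (∈-concatMap⁻; ∈-map⁻; ∈-upTo⁻)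
open import Data.List.Relation.Unary.Any using (here; there)
open import Data.List.Relation.Unary.All as All using (All; []; _∷_)
open import Data.List.Relation.Unary.AllPairs using ([]; _∷_)
open import Data.Nat as ℕ using (zero; z≤n; s≤s)
open import Data.List.Relation.Unary.Unique.DecPropositional ℕ._≟_ using (Unique; unique?)
open import Data.Nat.Properties as ℕₚ
  using (≤-refl; ≤-trans; ≤-reflexive; ≤-antisym; ≰⇒>; ≤∧≢⇒<; <⇒≢; <-trans; m<n⇒m<1+n;
         m<m+n; +-suc; *-suc; +-monoˡ-≤; +-cancelʳ-≤; ≤ᵇ⇒≤; ≤⇒≤ᵇ)
open import Data.Nat.Tactic.RingSolver as ℕ-Solver using ()
open import Data.Product using (_,_; proj₁; proj₂)
open import Data.Sum using (_⊎_; inj₁; inj₂)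
import Data.Sum as Sum
open import Data.Unit using (⊤; tt)
open import Algebra.Properties.CommutativeSemigroup *-commutativeSemigroup using (x∙yz≈y∙xz)
open import Function using (_∘_; Equivalence)
open import Level using (Level)
open import Relation.Nullary using (¬_; Dec; yes; no; does)
open import Relation.Nullary.Decidable using (⌊_⌋; ¬?; T?)
open import Relation.Unary using (Pred; Decidable)
open import Relation.Binary.PropositionalEquality
  using (_≢_; refl; sym; trans; cong; cong₂; subst; ≢-sym; module ≡-Reasoning)

open ≡-Reasoning

private variable
  a b : Level
  A : Set a
  B : Set b

∑ : (A → ℤ) → List A → ℤ
∑ f = foldr (λ x acc → f x + acc) (+ 0)

∑-cong-∈ : ∀ (S : List A) {f g : A → ℤ} → (∀ {x} → x ∈ S → f x ≡ g x) → ∑ f S ≡ ∑ g S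
∑-cong-∈ []      e = refl
∑-cong-∈ (x ∷ S) e = cong₂ _+_ (e (here refl)) (∑-cong-∈ S (e ∘ there))

∑-cong : ∀ (S : List A) {f g : A → ℤ} → (∀ x → f x ≡ g x) → ∑ f S ≡ ∑ g S
∑-cong S e = ∑-cong-∈ S (λ {x} _ → e x)

∑-vanishing : ∀ (S : List A) {f : A → ℤ} → (∀ {x} → x ∈ S → f x ≡ + 0) → ∑ f S ≡ + 0
∑-vanishing []      e = refl
∑-vanishing (x ∷ S) e = cong₂ _+_ (e (here refl)) (∑-vanishing S (e ∘ there))

∑-++ : ∀ (f : A → ℤ) S T → ∑ f (S ++ T) ≡ ∑ f S + ∑ f T
∑-++ f []      T = sym (+-identityˡ _)
∑-++ f (x ∷ S) T = trans (cong (_+_ (f x)) (∑-++ f S T)) (sym (+-assoc (f x) _ _))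

∑-+ : ∀ (f g : A → ℤ) S → ∑ (λ x → f x + g x) S ≡ ∑ f S + ∑ g S
∑-+ f g []      = refl
∑-+ f g (x ∷ S) = trans (cong (_+_ (f x + g x)) (∑-+ f g S)) (interchange (f x) (g x) _ _)
  where
  interchange : ∀ p q r s → (p + q) + (r + s) ≡ (p + r) + (q + s)
  interchange = solve-∀

∑-map : ∀ (f : B → ℤ) (g : A → B) S → ∑ f (map g S) ≡ ∑ (f ∘ g) S
∑-map f g []      = refl
∑-map f g (x ∷ S) = cong (_+_ (f (g x))) (∑-map f g S)

∑-concatMap : ∀ (f : B → ℤ) (g : A → List B) S →
              ∑ f (concatMap g S) ≡ ∑ (λ x → ∑ f (g x)) S
∑-concatMap f g []      = refl
∑-concatMap f g (x ∷ S) =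
  trans (∑-++ f (g x) (concatMap g S)) (cong (_+_ (∑ f (g x))) (∑-concatMap f g S))

∑-filter : ∀ {p} {P : Pred A p} (P? : Decidable P) (f : A → ℤ) S →
           ∑ f (filter P? S) ≡ ∑ (λ x → if does (P? x) then f x else + 0) S
∑-filter P? f []      = refl
∑-filter P? f (x ∷ S) with does (P? x)
... | true  = cong (_+_ (f x)) (∑-filter P? f S)
... | false = trans (∑-filter P? f S) (sym (+-identityˡ _))

∑-filter-difference : ∀ {p} {P : Pred A p} (P? : Decidable P) (f : A → ℤ) S →
                      ∑ f (filter P? S) - ∑ f (filter (¬? ∘ P?) S)
                        ≡ ∑ (λ x → if does (P? x) then f x else - f x) S
∑-filter-difference P? f []      = refl
∑-filter-difference P? f (x ∷ S) with P? x
... | yes _ = trans (regroup (f x) (∑ f (filter P? S)) (∑ f (filter (¬? ∘ P?) S)))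
                  (cong (_+_ (f x)) (∑-filter-difference P? f S))
  where
  regroup : ∀ p q r → (p + q) - r ≡ p + (q - r)
  regroup = solve-∀
... | no _  = trans (regroup (f x) (∑ f (filter P? S)) (∑ f (filter (¬? ∘ P?) S)))
                  (cong (_+_ (- f x)) (∑-filter-difference P? f S))
  where
  regroup : ∀ p q r → q - (p + r) ≡ - p + (q - r)
  regroup = solve-∀

∑-upTo-suc : ∀ (f : ℕ → ℤ) n → ∑ f (upTo (suc n)) ≡ ∑ f (upTo n) + f n
∑-upTo-suc f n = begin
  ∑ f (upTo (suc n))         ≡⟨ cong (∑ f) (upTo-∷ʳ n) ⟨
  ∑ f (upTo n ∷ʳ n)          ≡⟨ ∑-++ f (upTo n) [ n ] ⟩
  ∑ f (upTo n) + (f n + + 0) ≡⟨ cong (_+_ (∑ f (upTo n))) (+-identityʳ (f n)) ⟩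
  ∑ f (upTo n) + f n         ∎

∑-upTo-δ : ∀ {n} (f : ℕ → ℤ) {c} → c ℕ.< n → (∀ {i} → i ℕ.< n → i ≢ c → f i ≡ + 0) →
           ∑ f (upTo n) ≡ f c
∑-upTo-δ {suc n} f {c} c<1+n off with c ℕ.≟ n
... | yes refl = trans (∑-upTo-suc f n) (trans (cong (_+ f n) below) (+-identityˡ (f n)))
  where
  below : ∑ f (upTo n) ≡ + 0
  below = ∑-vanishing (upTo n) λ i∈ → off (m<n⇒m<1+n (∈-upTo⁻ i∈)) (<⇒≢ (∈-upTo⁻ i∈))
... | no c≢n =
  trans (∑-upTo-suc f n) (trans (cong₂ _+_ rest (off ≤-refl (≢-sym c≢n))) (+-identityʳ (f c)))
  where
  rest : ∑ f (upTo n) ≡ f c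
  rest = ∑-upTo-δ f (≤∧≢⇒< (ℕ.s≤s⁻¹ c<1+n) c≢n) (off ∘ m<n⇒m<1+n)

sgn : List ℤ → ℤ
sgn w = -1ℤ ^ neg w

signed-by-parity : ∀ k (x : ℤ) → (if does (k ℕ.% 2 ℕ.≟ 0) then x else - x) ≡ -1ℤ ^ k * x
signed-by-parity zero          x = sym (*-identityˡ x)
signed-by-parity (suc zero)    x = sym (-1*i≡-i x)
signed-by-parity (suc (suc k)) x = trans (signed-by-parity k x) (sign-squared (-1ℤ ^ k) x)
  where
  sign-squared : ∀ s x → s * x ≡ -1ℤ * (-1ℤ * s) * x
  sign-squared = solve-∀

-- An index word a stands for the absolute values |π_j| = a_j + 1.
indexWords : ℕ → ℕ → List (List ℕ)
indexWords n zero    = [] ∷ []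
indexWords n (suc m) = concatMap (λ i → map (i ∷_) (indexWords n m)) (upTo n)

∈-indexWords⁻ : ∀ {n m a} → a ∈ indexWords n m → All (ℕ._< n) a × length a ≡ m
∈-indexWords⁻ {m = zero} (here refl) = [] , refl
∈-indexWords⁻ {n} {suc m} a∈
  with i , i∈ , a∈ᵢ ← find (∈-concatMap⁻ (λ i → map (i ∷_) (indexWords n m)) {xs = upTo n} a∈)
  with b , b∈ , refl ← ∈-map⁻ (i ∷_) a∈ᵢ
  = ∈-upTo⁻ i∈ ∷ proj₁ (∈-indexWords⁻ {n} {m} b∈) , cong suc (proj₂ (∈-indexWords⁻ {n} {m} b∈))

∑-indexWords-suc : ∀ n m (f : List ℕ → ℤ) →
                   ∑ f (indexWords n (suc m)) ≡ ∑ (λ i → ∑ (f ∘ (i ∷_)) (indexWords n m)) (upTo n)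
∑-indexWords-suc n m f =
  trans (∑-concatMap f _ (upTo n)) (∑-cong (upTo n) λ i → ∑-map f (i ∷_) (indexWords n m))

Σsigns : List ℕ → (List ℤ → ℤ) → ℤ
Σsigns []      f = f []
Σsigns (i ∷ a) f = Σsigns a (λ w → f (+[1+ i ] ∷ w)) + Σsigns a (λ w → f (-[1+ i ] ∷ w))

Σsigns-cong-abs : ∀ a {f g : List ℤ → ℤ} → (∀ w → map ∣_∣ w ≡ map suc a → f w ≡ g w) →
                  Σsigns a f ≡ Σsigns a g
Σsigns-cong-abs []      e = e [] refl
Σsigns-cong-abs (i ∷ a) e =
  cong₂ _+_ (Σsigns-cong-abs a λ w eq → e (+[1+ i ] ∷ w) (cong (suc i ∷_) eq))
            (Σsigns-cong-abs a λ w eq → e (-[1+ i ] ∷ w) (cong (suc i ∷_) eq))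

Σsigns-factor : ∀ a c (f g : List ℤ → ℤ) → (∀ w → f w ≡ c * g w) → Σsigns a f ≡ c * Σsigns a g
Σsigns-factor []      c f g e = e []
Σsigns-factor (i ∷ a) c f g e =
  trans (cong₂ _+_ (Σsigns-factor a c _ _ (e ∘ (+[1+ i ] ∷_)))
                   (Σsigns-factor a c _ _ (e ∘ (-[1+ i ] ∷_))))
        (sym (*-distribˡ-+ c _ _))

Σsigns-if : ∀ a b (g : List ℤ → ℤ) →
            Σsigns a (λ w → if b then g w else + 0) ≡ (if b then Σsigns a g else + 0)
Σsigns-if a true  g = refl
Σsigns-if a false g = Σsigns-factor a (+ 0) _ g (λ _ → refl)

Σsigns-signed : ∀ i a (f : List ℤ → ℤ) →
                Σsigns (i ∷ a) (λ w → sgn w * f w)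
                  ≡ Σsigns a (λ w → sgn w * f (+[1+ i ] ∷ w))
                    - Σsigns a (λ w → sgn w * f (-[1+ i ] ∷ w))
Σsigns-signed i a f =
  cong (_+_ (Σsigns a (λ w → sgn w * f (+[1+ i ] ∷ w))))
       (trans (Σsigns-factor a -1ℤ _ (λ w → sgn w * f (-[1+ i ] ∷ w)) (λ w → *-assoc -1ℤ (sgn w) _))
              (-1*i≡-i _))

∑-words : ∀ n m (f : List ℤ → ℤ) → ∑ f (words n m) ≡ ∑ (λ a → Σsigns a f) (indexWords n m)
∑-words n zero    f = refl
∑-words n (suc m) f = begin
    ∑ f (words n (suc m))
  ≡⟨ ∑-concatMap f _ (letters n) ⟩
    ∑ (λ y → ∑ f (map (y ∷_) (words n m))) (letters n)
  ≡⟨ ∑-cong (letters n) (λ y → ∑-map f (y ∷_) (words n m)) ⟩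
    ∑ (λ y → ∑ (f ∘ (y ∷_)) (words n m)) (letters n)
  ≡⟨ ∑-concatMap (λ y → ∑ (f ∘ (y ∷_)) (words n m)) (λ i → +[1+ i ] ∷ -[1+ i ] ∷ []) (upTo n) ⟩
    ∑ (λ i → ∑ (f ∘ (+[1+ i ] ∷_)) (words n m) + (∑ (f ∘ (-[1+ i ] ∷_)) (words n m) + + 0)) (upTo n)
  ≡⟨ ∑-cong (upTo n) both-signs ⟩
    ∑ (λ i → ∑ (λ a → Σsigns (i ∷ a) f) (indexWords n m)) (upTo n)
  ≡⟨ ∑-indexWords-suc n m (λ a → Σsigns a f) ⟨
    ∑ (λ a → Σsigns a f) (indexWords n (suc m))
  ∎
  where
  both-signs : ∀ i → ∑ (f ∘ (+[1+ i ] ∷_)) (words n m) + (∑ (f ∘ (-[1+ i ] ∷_)) (words n m) + + 0)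
                     ≡ ∑ (λ a → Σsigns (i ∷ a) f) (indexWords n m)
  both-signs i =
    trans (cong₂ _+_ (∑-words n m _) (trans (+-identityʳ _) (∑-words n m _)))
          (sym (∑-+ (λ a → Σsigns a (f ∘ (+[1+ i ] ∷_))) (λ a → Σsigns a (f ∘ (-[1+ i ] ∷_)))
                    (indexWords n m)))

-- In the predicates on index words below, c is the absolute value of the preceding
-- letter (c = 0 before π₁, as π₀ = 0).
ascendingFrom : ℕ → List ℕ → Bool
ascendingFrom c []      = true
ascendingFrom c (i ∷ a) = (c ℕ.≤ᵇ i) ∧ ascendingFrom (suc i) a

ascending-∷⁻ : ∀ c i a → T (ascendingFrom c (i ∷ a)) → c ≤ i × T (ascendingFrom (suc i) a)
ascending-∷⁻ c i a asc with c≤ᵇi , rest ← Equivalence.to T-∧ asc = ≤ᵇ⇒≤ c i c≤ᵇi , rest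

ascending-∷⁺ : ∀ {c i} a → c ≤ i → T (ascendingFrom (suc i) a) → T (ascendingFrom c (i ∷ a))
ascending-∷⁺ a c≤i rest = Equivalence.from T-∧ (≤⇒≤ᵇ c≤i , rest)

ascending-length : ∀ {n c a} → c ≤ n → All (ℕ._< n) a → T (ascendingFrom c a) → c ℕ.+ length a ≤ n
ascending-length {c = c} c≤n [] _ = ≤-trans (≤-reflexive (ℕₚ.+-identityʳ c)) c≤n
ascending-length {c = c} {i ∷ a} _ (i<n ∷ a<n) asc =
  ≤-trans (≤-trans (≤-reflexive (+-suc c (length a))) (+-monoˡ-≤ (length a) (s≤s c≤i)))
          (ascending-length i<n a<n rest)
  where
  c≤i = proj₁ (ascending-∷⁻ c i a asc)
  rest = proj₂ (ascending-∷⁻ c i a asc)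

ascending-head≡ : ∀ {n c i a} → T (ascendingFrom c (i ∷ a)) → All (ℕ._< n) (i ∷ a) →
                  c ℕ.+ length (i ∷ a) ≡ n → i ≡ c
ascending-head≡ {_} {c} {i} {a} asc (i<n ∷ a<n) fills =
  ≤-antisym i≤c (proj₁ (ascending-∷⁻ c i a asc))
  where
  bound : suc i ℕ.+ length a ≤ suc c ℕ.+ length a
  bound = ≤-trans (ascending-length i<n a<n (proj₂ (ascending-∷⁻ c i a asc)))
                  (≤-reflexive (trans (sym fills) (+-suc c (length a))))
  i≤c : i ≤ c
  i≤c = ℕ.s≤s⁻¹ (+-cancelʳ-≤ (length a) (suc i) (suc c) bound)

if-false : ∀ {b} {x : ℤ} → ¬ T b → (if b then x else + 0) ≡ + 0
if-false {false} _  = refl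
if-false {true}  ¬b = ⊥-elim (¬b tt)

∑-ascending : ∀ {n} c m (x : ℤ) → c ℕ.+ m ≡ n →
              ∑ (λ a → if ascendingFrom c a then x else + 0) (indexWords n m) ≡ x
∑-ascending c zero    x _ = +-identityʳ x
∑-ascending {n} c (suc m) x fills = begin
    ∑ ascending (indexWords n (suc m))
  ≡⟨ ∑-indexWords-suc n m ascending ⟩
    ∑ (λ i → ∑ (ascending ∘ (i ∷_)) (indexWords n m)) (upTo n)
  ≡⟨ ∑-upTo-δ _ c<n off-diagonal ⟩
    ∑ (ascending ∘ (c ∷_)) (indexWords n m)
  ≡⟨ ∑-cong (indexWords n m) (λ a → cong (λ b → if b ∧ ascendingFrom (suc c) a then x else + 0)
                                         c≤ᵇc) ⟩
    ∑ (λ a → if ascendingFrom (suc c) a then x else + 0) (indexWords n m)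
  ≡⟨ ∑-ascending (suc c) m x (trans (sym (+-suc c m)) fills) ⟩
    x
  ∎
  where
  ascending : List ℕ → ℤ
  ascending a = if ascendingFrom c a then x else + 0
  c<n : c ℕ.< n
  c<n = subst (c ℕ.<_) fills (m<m+n c ℕ.z<s)
  c≤ᵇc : (c ℕ.≤ᵇ c) ≡ true
  c≤ᵇc = Equivalence.to T-≡ (≤⇒≤ᵇ (≤-refl {c}))
  off-diagonal : ∀ {i} → i ℕ.< n → i ≢ c → ∑ (ascending ∘ (i ∷_)) (indexWords n m) ≡ + 0
  off-diagonal i<n i≢c = ∑-vanishing (indexWords n m) λ {a} a∈ →
    let a<n , len = ∈-indexWords⁻ {n} {m} a∈
    in if-false λ asc →
         i≢c (ascending-head≡ {c = c} asc (i<n ∷ a<n) (trans (cong (λ l → c ℕ.+ suc l) len) fills))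

HeadAbove : ℕ → List ℕ → Set
HeadAbove i []      = ⊤
HeadAbove i (k ∷ _) = i ℕ.< k

data HasLocalMin : ℕ → List ℕ → Set where
  here  : ∀ {c i a} → suc i ℕ.< c → HeadAbove i a → HasLocalMin c (i ∷ a)
  there : ∀ {c i a} → HasLocalMin (suc i) a → HasLocalMin c (i ∷ a)

data HasAdjacentRepeat : ℕ → List ℕ → Set where
  here  : ∀ {c i a} → c ≡ suc i → HasAdjacentRepeat c (i ∷ a)
  there : ∀ {c i a} → HasAdjacentRepeat (suc i) a → HasAdjacentRepeat c (i ∷ a)

ascending-headAbove : ∀ i a → T (ascendingFrom (suc i) a) → HeadAbove i a
ascending-headAbove i []      _   = tt
ascending-headAbove i (k ∷ a) asc = proj₁ (ascending-∷⁻ (suc i) k a asc)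

nonAscending-shape : ∀ c a → ¬ T (ascendingFrom c a) → HasLocalMin c a ⊎ HasAdjacentRepeat c a
nonAscending-shape c []      ¬asc = ⊥-elim (¬asc tt)
nonAscending-shape c (i ∷ a) ¬asc with T? (ascendingFrom (suc i) a)
... | no ¬rest = Sum.map there there (nonAscending-shape (suc i) a ¬rest)
... | yes rest with c ℕ.≟ suc i
...   | yes c≡1+i = inj₂ (here c≡1+i)
...   | no c≢1+i  = inj₁ (here (≤∧≢⇒< (≰⇒> c≰i) (≢-sym c≢1+i)) (ascending-headAbove i a rest))
  where
  c≰i : ¬ c ≤ i
  c≰i c≤i = ¬asc (ascending-∷⁺ a c≤i rest)

ascending-unique : ∀ c a → T (ascendingFrom c a) → All (c ℕ.<_) (map suc a) × Unique (map suc a)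
ascending-unique c []      _   = [] , []
ascending-unique c (i ∷ a) asc =
  s≤s c≤i ∷ All.map (<-trans (s≤s c≤i)) above , All.map <⇒≢ above ∷ unique
  where
  c≤i = proj₁ (ascending-∷⁻ c i a asc)
  above = proj₁ (ascending-unique (suc i) a (proj₂ (ascending-∷⁻ c i a asc)))
  unique = proj₂ (ascending-unique (suc i) a (proj₂ (ascending-∷⁻ c i a asc)))

repeat-nonUnique : ∀ {i a} → HasAdjacentRepeat (suc i) a → ¬ Unique (suc i ∷ map suc a)
repeat-nonUnique (here 1+i≡1+k) ((1+i≢1+k ∷ _) ∷ _) = 1+i≢1+k 1+i≡1+k
repeat-nonUnique (there rep)    (_ ∷ unique)        = repeat-nonUnique rep unique

turns : List ℤ → ℕ
turns π = peaksOf π ℕ.+ valleysOf π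

turn : ℤ → ℤ → ℤ → ℕ
turn x y z = (if ⌊ x <? y ⌋ ∧ ⌊ z <? y ⌋ then 1 else 0)
         ℕ.+ (if ⌊ y <? x ⌋ ∧ ⌊ y <? z ⌋ then 1 else 0)

turns-∷ : ∀ x y z r → turns (x ∷ y ∷ z ∷ r) ≡ turn x y z ℕ.+ turns (y ∷ z ∷ r)
turns-∷ x y z r =
  interchange (if ⌊ x <? y ⌋ ∧ ⌊ z <? y ⌋ then 1 else 0) (peaksOf (y ∷ z ∷ r))
              (if ⌊ y <? x ⌋ ∧ ⌊ y <? z ⌋ then 1 else 0) (valleysOf (y ∷ z ∷ r))
  where
  interchange : ∀ p q r s → (p ℕ.+ q) ℕ.+ (r ℕ.+ s) ≡ (p ℕ.+ r) ℕ.+ (q ℕ.+ s)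
  interchange = ℕ-Solver.solve-∀

positive : ℤ → Bool
positive (+ _)    = true
positive -[1+ _ ] = false

⌊⌋-yes : ∀ {p} {P : Set p} (P? : Dec P) → P → ⌊ P? ⌋ ≡ true
⌊⌋-yes (yes _) _ = refl
⌊⌋-yes (no ¬p) p = ⊥-elim (¬p p)

⌊⌋-no : ∀ {p} {P : Set p} (P? : Dec P) → ¬ P → ⌊ P? ⌋ ≡ false
⌊⌋-no (yes p) ¬p = ⊥-elim (¬p p)
⌊⌋-no (no _)  _  = refl

dominated-comparison : ∀ s y → ∣ s ∣ ℕ.< ∣ y ∣ →
                       (⌊ s <? y ⌋ ≡ positive y) × (⌊ y <? s ⌋ ≡ not (positive y))
dominated-comparison (+ k)    +[1+ j ] (s≤s k≤j) =
  ⌊⌋-yes (+ k <? +[1+ j ]) (ℤ.+<+ (s≤s k≤j)) ,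
  ⌊⌋-no (+[1+ j ] <? + k) λ { (ℤ.+<+ j<k) → ℕₚ.<⇒≱ j<k (ℕₚ.m≤n⇒m≤1+n k≤j) }
dominated-comparison -[1+ k ] +[1+ j ] _         = refl , refl
dominated-comparison (+ k)    -[1+ j ] _         = refl , refl
dominated-comparison -[1+ k ] -[1+ j ] (s≤s k<j) =
  ⌊⌋-no (-[1+ k ] <? -[1+ j ]) (λ { (ℤ.-<- j<k) → ℕₚ.<-asym j<k k<j }) ,
  ⌊⌋-yes (-[1+ j ] <? -[1+ k ]) (ℤ.-<- k<j)

SameSide : ℤ → ℤ → ℤ → Set
SameSide w u v = (⌊ u <? w ⌋ ≡ ⌊ v <? w ⌋) × (⌊ w <? u ⌋ ≡ ⌊ w <? v ⌋)

dominated-sameSide : ∀ w u v → ∣ u ∣ ℕ.< ∣ w ∣ → ∣ v ∣ ℕ.< ∣ w ∣ → SameSide w u v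
dominated-sameSide w u v u<w v<w =
  trans (proj₁ (dominated-comparison u w u<w)) (sym (proj₁ (dominated-comparison v w v<w))) ,
  trans (proj₂ (dominated-comparison u w u<w)) (sym (proj₂ (dominated-comparison v w v<w)))

turn-congˡ : ∀ {x x′ y z} → SameSide y x x′ → turn x y z ≡ turn x′ y z
turn-congˡ (e₁ , e₂) rewrite e₁ | e₂ = refl

turn-congʳ : ∀ {x y z z′} → SameSide y z z′ → turn x y z ≡ turn x y z′
turn-congʳ (e₁ , e₂) rewrite e₁ | e₂ = refl

turn-congᵐ : ∀ {x y y′ z} → SameSide x y y′ → SameSide z y y′ → turn x y z ≡ turn x y′ z
turn-congᵐ (e₁ , e₂) (e₃ , e₄) rewrite e₁ | e₂ | e₃ | e₄ = refl

turn-ascending : ∀ {x y z} → ∣ x ∣ ℕ.< ∣ y ∣ → ∣ y ∣ ℕ.< ∣ z ∣ →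
                 turn x y z ≡ (if positive y xor positive z then 1 else 0)
turn-ascending {x} {y} {z} x<y y<z
  rewrite proj₁ (dominated-comparison x y x<y) | proj₂ (dominated-comparison x y x<y)
        | proj₁ (dominated-comparison y z y<z) | proj₂ (dominated-comparison y z y<z)
  = by-signs (positive y) (positive z)
  where
  by-signs : ∀ b c → (if b ∧ not c then 1 else 0) ℕ.+ (if not b ∧ c then 1 else 0)
                     ≡ (if b xor c then 1 else 0)
  by-signs true  true  = refl
  by-signs true  false = refl
  by-signs false true  = refl
  by-signs false false = refl

module _ (t : ℤ) where

  -- G a is the signed contribution of the permutations with index word a; K x y a is the
  -- analogous sum for a tail that follows the letters x y.
  K : ℤ → ℤ → List ℕ → ℤ
  K x y a = Σsigns a (λ w → sgn w * t ^ turns (x ∷ y ∷ w))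

  G : List ℕ → ℤ
  G a = Σsigns a (λ w → sgn w * t ^ altrunsB w)

  K-step : ∀ x y i a → K x y (i ∷ a) ≡ t ^ turn x y +[1+ i ] * K y +[1+ i ] a
                                     - t ^ turn x y -[1+ i ] * K y -[1+ i ] a
  K-step x y i a = trans (Σsigns-signed i a (λ w → t ^ turns (x ∷ y ∷ w)))
                         (cong₂ _-_ (next +[1+ i ]) (next -[1+ i ]))
    where
    peel : ∀ z w → sgn w * t ^ turns (x ∷ y ∷ z ∷ w)
                   ≡ t ^ turn x y z * (sgn w * t ^ turns (y ∷ z ∷ w))
    peel z w = begin
        sgn w * t ^ turns (x ∷ y ∷ z ∷ w)
      ≡⟨ cong (λ e → sgn w * t ^ e) (turns-∷ x y z w) ⟩
        sgn w * t ^ (turn x y z ℕ.+ turns (y ∷ z ∷ w))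
      ≡⟨ cong (sgn w *_) (^-distribˡ-+-* t (turn x y z) _) ⟩
        sgn w * (t ^ turn x y z * t ^ turns (y ∷ z ∷ w))
      ≡⟨ x∙yz≈y∙xz (sgn w) (t ^ turn x y z) _ ⟩
        t ^ turn x y z * (sgn w * t ^ turns (y ∷ z ∷ w))
      ∎
    next : ∀ z → Σsigns a (λ w → sgn w * t ^ turns (x ∷ y ∷ z ∷ w)) ≡ t ^ turn x y z * K y z a
    next z = Σsigns-factor a (t ^ turn x y z) _ _ (peel z)

  G-step : ∀ i a → G (i ∷ a) ≡ t * K (+ 0) +[1+ i ] a - t * K (+ 0) -[1+ i ] a
  G-step i a = trans (Σsigns-signed i a (λ w → t ^ altrunsB w))
                     (cong₂ _-_ (next +[1+ i ]) (next -[1+ i ]))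
    where
    peel : ∀ z w → sgn w * t ^ altrunsB (z ∷ w) ≡ t * (sgn w * t ^ turns (+ 0 ∷ z ∷ w))
    peel z w = begin
        sgn w * t ^ (turns (+ 0 ∷ z ∷ w) ℕ.+ 1)
      ≡⟨ cong (λ e → sgn w * t ^ e) (ℕₚ.+-comm (turns (+ 0 ∷ z ∷ w)) 1) ⟩
        sgn w * (t * t ^ turns (+ 0 ∷ z ∷ w))
      ≡⟨ x∙yz≈y∙xz (sgn w) t _ ⟩
        t * (sgn w * t ^ turns (+ 0 ∷ z ∷ w))
      ∎
    next : ∀ z → Σsigns a (λ w → sgn w * t ^ altrunsB (z ∷ w)) ≡ t * K (+ 0) z a
    next z = Σsigns-factor a t _ _ (peel z)

  Q : Bool → ℕ → ℤ
  Q _     zero    = + 1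
  Q true  (suc m) = Q true m - t * Q false m
  Q false (suc m) = t * Q true m - Q false m

  Δ : ℕ → ℤ
  Δ zero    = t
  Δ (suc m) = t * Q true m - t * Q false m

  Q-suc : ∀ b m → t ^ (if b xor true then 1 else 0) * Q true m
                - t ^ (if b xor false then 1 else 0) * Q false m ≡ Q b (suc m)
  Q-suc true  m = ring t (Q true m) (Q false m)
    where
    ring : ∀ t p q → + 1 * p - t * + 1 * q ≡ p - t * q
    ring = solve-∀
  Q-suc false m = ring t (Q true m) (Q false m)
    where
    ring : ∀ t p q → t * + 1 * p - + 1 * q ≡ t * p - q
    ring = solve-∀

  K-ascending : ∀ x y a → ∣ x ∣ ℕ.< ∣ y ∣ → T (ascendingFrom ∣ y ∣ a) →
                K x y a ≡ Q (positive y) (length a)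
  K-ascending x y []      _   _   = refl
  K-ascending x y (i ∷ a) x<y asc = begin
      K x y (i ∷ a)
    ≡⟨ K-step x y i a ⟩
      t ^ turn x y +[1+ i ] * K y +[1+ i ] a - t ^ turn x y -[1+ i ] * K y -[1+ i ] a
    ≡⟨ cong₂ (λ c d → t ^ c * K y +[1+ i ] a - t ^ d * K y -[1+ i ] a)
             (turn-ascending {x} x<y y<i) (turn-ascending {x} x<y y<i) ⟩
      flipWeight true * K y +[1+ i ] a - flipWeight false * K y -[1+ i ] a
    ≡⟨ cong₂ (λ p q → flipWeight true * p - flipWeight false * q)
             (K-ascending y +[1+ i ] a y<i rest) (K-ascending y -[1+ i ] a y<i rest) ⟩
      flipWeight true * Q true (length a) - flipWeight false * Q false (length a)
    ≡⟨ Q-suc (positive y) (length a) ⟩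
      Q (positive y) (length (i ∷ a))
    ∎
    where
    flipWeight : Bool → ℤ
    flipWeight b = t ^ (if positive y xor b then 1 else 0)
    y<i : ∣ y ∣ ℕ.< suc i
    y<i = s≤s (proj₁ (ascending-∷⁻ ∣ y ∣ i a asc))
    rest = proj₂ (ascending-∷⁻ ∣ y ∣ i a asc)

  G-ascending : ∀ a → T (ascendingFrom 0 a) → G a ≡ Δ (length a)
  G-ascending []      _   = trans (*-identityˡ (t * + 1)) (*-identityʳ t)
  G-ascending (i ∷ a) asc =
    trans (G-step i a) (cong₂ (λ p q → t * p - t * q) (K-ascending (+ 0) +[1+ i ] a (s≤s z≤n) asc)
                                                      (K-ascending (+ 0) -[1+ i ] a (s≤s z≤n) asc))

  K-congˡ : ∀ {x x′ y} a → SameSide y x x′ → K x y a ≡ K x′ y a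
  K-congˡ                []      _    = refl
  K-congˡ {x} {x′} {y} (i ∷ a) same =
    trans (K-step x y i a)
          (trans (cong₂ (λ c d → t ^ c * K y +[1+ i ] a - t ^ d * K y -[1+ i ] a)
                        (turn-congˡ same) (turn-congˡ same))
                 (sym (K-step x′ y i a)))

  K-flip : ∀ y i a → suc i ℕ.< ∣ y ∣ → HeadAbove i a → K y +[1+ i ] a ≡ K y -[1+ i ] a
  K-flip y i []      _   _   = refl
  K-flip y i (k ∷ a) i<y i<k =
    trans (K-step y +[1+ i ] k a)
          (trans (cong₂ _-_ (flipped +[1+ k ] (s≤s i<k)) (flipped -[1+ k ] (s≤s i<k)))
                 (sym (K-step y -[1+ i ] k a)))
    where
    ±i-alike : ∀ w → suc i ℕ.< ∣ w ∣ → SameSide w +[1+ i ] -[1+ i ]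
    ±i-alike w i<w = dominated-sameSide w _ _ i<w i<w
    flipped : ∀ z → suc i ℕ.< ∣ z ∣ →
              t ^ turn y +[1+ i ] z * K +[1+ i ] z a ≡ t ^ turn y -[1+ i ] z * K -[1+ i ] z a
    flipped z i<z = cong₂ (λ c κ → t ^ c * κ) (turn-congᵐ (±i-alike y i<y) (±i-alike z i<z))
                                               (K-congˡ a (±i-alike z i<z))

  K-localMin : ∀ x y a → HasLocalMin ∣ y ∣ a → K x y a ≡ + 0
  K-localMin x y (i ∷ a) (here i<y above) = begin
      K x y (i ∷ a)
    ≡⟨ K-step x y i a ⟩
      t ^ turn x y +[1+ i ] * K y +[1+ i ] a - t ^ turn x y -[1+ i ] * K y -[1+ i ] a
    ≡⟨ cong₂ (λ c κ → t ^ c * κ - t ^ turn x y -[1+ i ] * K y -[1+ i ] a)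
             (turn-congʳ {x} (dominated-sameSide y _ _ i<y i<y)) (K-flip y i a i<y above) ⟩
      t ^ turn x y -[1+ i ] * K y -[1+ i ] a - t ^ turn x y -[1+ i ] * K y -[1+ i ] a
    ≡⟨ +-inverseʳ (t ^ turn x y -[1+ i ] * K y -[1+ i ] a) ⟩
      + 0
    ∎
  K-localMin x y (i ∷ a) (there dip) = begin
      K x y (i ∷ a)
    ≡⟨ K-step x y i a ⟩
      t ^ turn x y +[1+ i ] * K y +[1+ i ] a - t ^ turn x y -[1+ i ] * K y -[1+ i ] a
    ≡⟨ cong₂ (λ κ κ′ → t ^ turn x y +[1+ i ] * κ - t ^ turn x y -[1+ i ] * κ′)
             (K-localMin y +[1+ i ] a dip) (K-localMin y -[1+ i ] a dip) ⟩
      t ^ turn x y +[1+ i ] * + 0 - t ^ turn x y -[1+ i ] * + 0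
    ≡⟨ cong₂ _-_ (*-zeroʳ (t ^ turn x y +[1+ i ])) (*-zeroʳ (t ^ turn x y -[1+ i ])) ⟩
      + 0
    ∎

  G-localMin : ∀ a → HasLocalMin 0 a → G a ≡ + 0
  G-localMin (i ∷ a) (there dip) =
    trans (G-step i a)
          (trans (cong₂ (λ κ κ′ → t * κ - t * κ′) (K-localMin (+ 0) +[1+ i ] a dip)
                                                  (K-localMin (+ 0) -[1+ i ] a dip))
                 (cong₂ _-_ (*-zeroʳ t) (*-zeroʳ t)))

  group-contribution : ∀ a → (if does (unique? (map suc a)) then G a else + 0)
                             ≡ (if ascendingFrom 0 a then Δ (length a) else + 0)
  group-contribution a with unique? (map suc a) | ascendingFrom 0 a in asc
  ... | yes _      | true  = G-ascending a (subst T (sym asc) tt)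
  ... | no ¬unique | true  = ⊥-elim (¬unique (proj₂ (ascending-unique 0 a (subst T (sym asc) tt))))
  ... | no _       | false = refl
  ... | yes unique | false with nonAscending-shape 0 a (subst T asc)
  ...   | inj₁ dip         = G-localMin a dip
  ...   | inj₂ (there rep) = ⊥-elim (repeat-nonUnique rep unique)

  signedDifference : ∀ n → R-D n t - R-BminusD n t ≡ Δ n
  signedDifference n = begin
      R-D n t - R-BminusD n t
    ≡⟨ ∑-filter-difference even? weight (signedPerms n) ⟩
      ∑ (λ π → if does (even? π) then weight π else - weight π) (signedPerms n)
    ≡⟨ ∑-cong (signedPerms n) (λ π → signed-by-parity (neg π) (weight π)) ⟩
      ∑ (λ π → sgn π * weight π) (signedPerms n)
    ≡⟨ ∑-filter (λ w → unique? (map ∣_∣ w)) (λ π → sgn π * weight π) (words n n) ⟩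
      ∑ uniqueWeight (words n n)
    ≡⟨ ∑-words n n uniqueWeight ⟩
      ∑ (λ a → Σsigns a uniqueWeight) (indexWords n n)
    ≡⟨ ∑-cong (indexWords n n) (λ a → trans (by-absolute-values a) (group-contribution a)) ⟩
      ∑ (λ a → if ascendingFrom 0 a then Δ (length a) else + 0) (indexWords n n)
    ≡⟨ ∑-cong-∈ (indexWords n n) (λ {a} a∈ →
         cong (λ m → if ascendingFrom 0 a then Δ m else + 0) (proj₂ (∈-indexWords⁻ {n} {n} a∈))) ⟩
      ∑ (λ a → if ascendingFrom 0 a then Δ n else + 0) (indexWords n n)
    ≡⟨ ∑-ascending 0 n (Δ n) refl ⟩
      Δ n
    ∎
    where
    even? = λ (π : List ℤ) → neg π ℕ.% 2 ℕ.≟ 0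
    weight : List ℤ → ℤ
    weight π = t ^ altrunsB π
    uniqueWeight : List ℤ → ℤ
    uniqueWeight w = if does (unique? (map ∣_∣ w)) then sgn w * weight w else + 0
    by-absolute-values : ∀ a → Σsigns a uniqueWeight
                               ≡ (if does (unique? (map suc a)) then G a else + 0)
    by-absolute-values a =
      trans (Σsigns-cong-abs a λ w abs≡ →
               cong (λ l → if does (unique? l) then sgn w * weight w else + 0) abs≡)
            (Σsigns-if a _ (λ w → sgn w * weight w))

  Q-even : ∀ j b → Q b (2 ℕ.* j) ≡ (+ 1 - t * t) ^ j
  Q-even zero    b = refl
  Q-even (suc j) b = trans (cong (Q b) (*-suc 2 j)) (two-steps b)
    where
    two-steps : ∀ b → Q b (suc (suc (2 ℕ.* j))) ≡ (+ 1 - t * t) ^ suc j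
    two-steps true  =
      trans (cong₂ (λ p q → (p - t * q) - t * (t * p - q)) (Q-even j true) (Q-even j false)) (ring t _)
      where
      ring : ∀ t u → (u - t * u) - t * (t * u - u) ≡ (+ 1 - t * t) * u
      ring = solve-∀
    two-steps false =
      trans (cong₂ (λ p q → t * (p - t * q) - (t * p - q)) (Q-even j true) (Q-even j false)) (ring t _)
      where
      ring : ∀ t u → t * (u - t * u) - (t * u - u) ≡ (+ 1 - t * t) * u
      ring = solve-∀

  Δ-even : ∀ k → 1 ≤ k → Δ (2 ℕ.* k) ≡ + 2 * t * (+ 1 - t) * ((+ 1 - t * t) ^ (k ∸ 1))
  Δ-even (suc j) _ = begin
      Δ (2 ℕ.* suc j)
    ≡⟨ cong Δ (*-suc 2 j) ⟩
      t * (Q true (2 ℕ.* j) - t * Q false (2 ℕ.* j)) - t * (t * Q true (2 ℕ.* j) - Q false (2 ℕ.* j))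
    ≡⟨ cong₂ (λ p q → t * (p - t * q) - t * (t * p - q)) (Q-even j true) (Q-even j false) ⟩
      t * (u - t * u) - t * (t * u - u)
    ≡⟨ ring t u ⟩
      + 2 * t * (+ 1 - t) * u
    ∎
    where
    u = (+ 1 - t * t) ^ j
    ring : ∀ t u → t * (u - t * u) - t * (t * u - u) ≡ + 2 * t * (+ 1 - t) * u
    ring = solve-∀

  Δ-odd : ∀ k → Δ (suc (2 ℕ.* k)) ≡ + 0
  Δ-odd k = trans (cong₂ (λ p q → t * p - t * q) (Q-even k true) (Q-even k false))
                  (+-inverseʳ (t * (+ 1 - t * t) ^ k))

theorem52 : ((k : ℕ) → 1 ≤ k → (t : ℤ) →
               R-D (2 Data.Nat.* k) t - R-BminusD (2 Data.Nat.* k) t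
                 ≡ + 2 * t * (+ 1 - t) * ((+ 1 - t * t) ^ (k ∸ 1)))
            × ((k : ℕ) → (t : ℤ) →
               R-D (suc (2 Data.Nat.* k)) t - R-BminusD (suc (2 Data.Nat.* k)) t ≡ + 0)
theorem52 = (λ k 1≤k t → trans (signedDifference t (2 ℕ.* k)) (Δ-even t k 1≤k))
          , (λ k t → trans (signedDifference t (suc (2 ℕ.* k))) (Δ-odd t k))
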